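{- Let $m>n$ be positive integers. There is a map $\Psi:\mathcal{D}_{m,n}\to\mathcal{D}_{m,n}$ such that for every $P\in\mathcal{D}_{m,n}$: $\Psi(\Psi(P))=P$, $\mathrm{comp}(\Psi(P))=\mathrm{comp}(P)$, $\widetilde{\mathrm{run}}(\Psi(P))=\mathrm{ret}(P)$ and $\mathrm{ret}(\Psi(P))=\widetilde{\mathrm{run}}(P)$.
   Context: An $m\times n$ rational Dyck path is a lattice path from $(0,0)$ to $(m,n)$ using unit north steps $N$ and east steps $E$ that stays weakly above the line $y=nx/m$; $\mathcal{D}_{m,n}$ is the set of these paths. For $P\in\mathcal{D}_{m,n}$, let $(u_1,\dots,u_n)$ be its coarea sequence, $u_i$ being the $x$-coordinate of the $i$-th north step of $P$ (bottom to top). With $k=\lfloor m/n\rfloor$, the ratio-run statistic is $\widetilde{\mathrm{run}}(P)=\min\{i\in\{1,\dots,n\}: ki\notin\{u_1,\dots,u_n\}\}$. The return statistic $\mathrm{ret}(P)$ is the number of north steps of $P$ from some $(i,j)$ to $(i,j+1)$ with $jm-in<n$. The composition type $\mathrm{comp}(P)$ is the composition of $n$ given by the lengths of the maximal blocks of consecutive north steps of $P$, in order. -}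

module Defs where

open import Data.Nat using (ℕ; zero; suc; _+_; _*_; _≤_; _<_; _/_)
open import Data.Nat.Properties using (_≟_)
open import Data.Bool using (Bool; true; false; if_then_else_)
open import Data.List using (List; []; _∷_; length; filter)
open import Data.List.Relation.Unary.All using (All)
open import Data.List.Relation.Unary.Any using (any?)
open import Data.Product using (Σ; _×_; _,_; proj₁)
open import Relation.Binary.PropositionalEquality using (_≡_)
open import Relation.Nullary using (does)

data Step : Set where
  N E : Step

#N : List Step → ℕ
#N []       = 0
#N (N ∷ w)  = suc (#N w)
#N (E ∷ w)  = #N w

#E : List Step → ℕ
#E []       = 0
#E (N ∷ w)  = #E w
#E (E ∷ w)  = suc (#E w)

pointsFrom : ℕ → ℕ → List Step → List (ℕ × ℕ)
pointsFrom x y []       = []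
pointsFrom x y (N ∷ w)  = (x , suc y) ∷ pointsFrom x (suc y) w
pointsFrom x y (E ∷ w)  = (suc x , y) ∷ pointsFrom (suc x) y w

-- A point (x , y) is weakly above the line y = n x / m  iff  x * n ≤ y * m.
WeaklyAbove : ℕ → ℕ → ℕ × ℕ → Set
WeaklyAbove m n (x , y) = x * n ≤ y * m

-- m × n rational Dyck path: from (0,0) to (m,n) with m east and n north steps,
-- every lattice point on it weakly above y = n x / m (since the path is
-- piecewise linear, checking its vertices suffices; (0,0) is on the line).
IsDyck : ℕ → ℕ → List Step → Set
IsDyck m n w = (#E w ≡ m) × (#N w ≡ n) × All (WeaklyAbove m n) (pointsFrom 0 0 w)

Dyck : ℕ → ℕ → Set
Dyck m n = Σ (List Step) (IsDyck m n)

path : ∀ {m n} → Dyck m n → List Step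
path = proj₁

-- Coarea sequence (u_1, …, u_n): x-coordinates of the north steps, bottom to top.
coareaFrom : ℕ → List Step → List ℕ
coareaFrom x []       = []
coareaFrom x (N ∷ w)  = x ∷ coareaFrom x w
coareaFrom x (E ∷ w)  = coareaFrom (suc x) w

coarea : List Step → List ℕ
coarea = coareaFrom 0

_∈ᵇ_ : ℕ → List ℕ → Bool
a ∈ᵇ us = does (any? (a ≟_) us)

-- Search for the least i ∈ {i₀, …, i₀ + fuel - 1} with k * i ∉ us;
-- returns i₀ + fuel if there is none.
firstMissing : ℕ → List ℕ → ℕ → ℕ → ℕ
firstMissing k us i zero        = i
firstMissing k us i (suc fuel)  =
  if (k * i) ∈ᵇ us then firstMissing k us (suc i) fuel else i

-- Ratio-run statistic with k = ⌊m/n⌋:  min { i ∈ {1..n} : k i ∉ {u_1..u_n} }.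
-- (For Dyck paths with m > n this minimum always exists; the default value
-- n + 1 of the search is never attained.)
runTilde : (m n : ℕ) .{{_ : Data.Nat.NonZero n}} → List Step → ℕ
runTilde m n w = firstMissing (m / n) (coarea w) 1 n

-- Return statistic: number of north steps from (i , j) to (i , j+1)
-- with j m - i n < n, i.e. (over ℕ) j * m < n + i * n.
retFrom : ℕ → ℕ → ℕ → ℕ → List Step → ℕ
retFrom m n i j []       = 0
retFrom m n i j (N ∷ w)  =
  (if does (Data.Nat._<?_ (j * m) (n + i * n)) then 1 else 0) + retFrom m n i (suc j) w
retFrom m n i j (E ∷ w)  = retFrom m n (suc i) j w

ret : ℕ → ℕ → List Step → ℕ
ret m n = retFrom m n 0 0

-- Composition type: lengths of the maximal blocks of consecutive north steps,
-- in order (all parts positive).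
-- compAcc c w : c = length of the current (unfinished) block of N's.
compAcc : ℕ → List Step → List ℕ
compAcc zero     []       = []
compAcc (suc c)  []       = suc c ∷ []
compAcc c        (N ∷ w)  = compAcc (suc c) w
compAcc zero     (E ∷ w)  = compAcc zero w
compAcc (suc c)  (E ∷ w)  = suc c ∷ compAcc zero w

comp : List Step → List ℕ
comp = compAcc 0

{-# OPTIONS --safe #-}
-- Cut a path into its maximal vertical runs: b₁ north steps at x = 0, then runs of
-- s₁, s₂, … steps at x-positions v₁ < v₂ < ⋯.  Staying weakly above the diagonal says
-- exactly that vᵢ ≤ cᵢ = ⌊hᵢ m / n⌋, where hᵢ is the height at which run i starts; these
-- ceilings satisfy c₁ ≥ k and cᵢ₊₁ ≥ cᵢ + k for k = ⌊m/n⌋.  Only the first step of a run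
-- can be a return, and it is one iff the run touches its ceiling, so ret = 1 + #{i : vᵢ = cᵢ};
-- and r̃un = 1 + the largest j with k, 2k, …, jk all among the vᵢ.  Keeping the run lengths
-- (hence comp and the ceilings) fixed, it remains to exchange "touches" and "chain length"
-- by an involution on the positions.  While the chain value is below the ceilings there is an
-- explicit bijection from positions with a touch onto positions with a nonempty chain that
-- removes one touch and adds one chain step; applying it, or its inverse, |touches − chain|
-- times is an involution swapping the two statistics.  An entry equal to both a chain value
-- and its ceiling counts for both and is left in place.
module Submission where

open import Defs
open import Data.Bool using (true; false; if_then_else_; _∨_)
open import Data.Bool.Properties using (∨-assoc; ∨-idem)
open import Data.Empty using (⊥)
open import Data.List using (List; []; _∷_; _++_; replicate; length)
open import Data.List.Properties using (++-identityʳ)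
open import Data.List.Relation.Unary.All as All using (All; []; _∷_)
open import Data.Nat using (ℕ; zero; suc; pred; ≢-nonZero⁻¹; _+_; _*_; _∸_; _/_; _≤_; _<_; s≤s; z≤n; NonZero)
open import Data.Nat.DivMod using (0/n≡0; m/n*n≤m; m*n/n≡m; /-monoˡ-≤; m≡m%n+[m/n]*n; m%n<n; m≥n⇒m/n>0)
open import Data.Nat.GeneralisedArithmetic using (fold; iterate; iterate-is-fold)
open import Data.Nat.ListAction using (sum)
open import Data.Nat.Properties
open import Data.Product using (Σ; _×_; _,_; proj₁; proj₂)
open import Data.Unit using (⊤; tt)
open import Function using (_∘_)
open import Relation.Binary using (Tri; tri<; tri≈; tri>)
open import Relation.Binary.PropositionalEquality
open import Relation.Nullary using (¬_; Dec; does; yes; no; contradiction)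
open import Relation.Nullary.Decidable using (dec-true; dec-false)

exchange : {X : Set} (a r : X → ℕ) (f g : X → X) → X → X
exchange a r f g x with <-cmp (r x) (a x)
... | tri< _ _ _ = fold x f (a x ∸ r x)
... | tri≈ _ _ _ = x
... | tri> _ _ _ = fold x g (r x ∸ a x)

module ExchangeCases {X : Set} (a r : X → ℕ) (f g : X → X) where

  exchange-< : ∀ x → r x < a x → exchange a r f g x ≡ fold x f (a x ∸ r x)
  exchange-< x r<a with <-cmp (r x) (a x)
  ... | tri< _ _ _   = refl
  ... | tri≈ r≮a _ _ = contradiction r<a r≮a
  ... | tri> r≮a _ _ = contradiction r<a r≮a

  exchange-≡ : ∀ x → r x ≡ a x → exchange a r f g x ≡ x
  exchange-≡ x r≡a with <-cmp (r x) (a x)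
  ... | tri< _ r≢a _ = contradiction r≡a r≢a
  ... | tri≈ _ _ _   = refl
  ... | tri> _ r≢a _ = contradiction r≡a r≢a

  exchange-> : ∀ x → a x < r x → exchange a r f g x ≡ fold x g (r x ∸ a x)
  exchange-> x a<r with <-cmp (r x) (a x)
  ... | tri< _ _ a≯r = contradiction a<r a≯r
  ... | tri≈ _ _ a≯r = contradiction a<r a≯r
  ... | tri> _ _ _   = refl

module _ {X : Set} (Ok : X → Set) where

  record Shift (j : ℕ) (a r : X → ℕ) (f g : X → X) (x : X) : Set where
    constructor shift
    field
      ok     : Ok (fold x f j)
      a-fall : j + a (fold x f j) ≡ a x
      r-rise : r (fold x f j) ≡ j + r x
      undo   : iterate g (fold x f j) j ≡ x

  IsLowering : (a r : X → ℕ) (f g : X → X) → Set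
  IsLowering a r f g = ∀ {x} → Ok x → 1 ≤ a x → Shift 1 a r f g x

  record Exchanges (a r : X → ℕ) (h : X → X) (x : X) : Set where
    constructor exchanges
    field
      ok         : Ok (h x)
      a-swap     : a (h x) ≡ r x
      r-swap     : r (h x) ≡ a x
      involutive : h (h x) ≡ x

module _ {X : Set} {Ok : X → Set} where
  open ≡-Reasoning

  shift-via : ∀ {a r f g x} y → f x ≡ y →
              Ok y → suc (a y) ≡ a x → r y ≡ suc (r x) → g y ≡ x → Shift Ok 1 a r f g x
  shift-via y refl = shift

  shift-iterate : ∀ {a r f g} → IsLowering Ok a r f g →
                  ∀ j {x} → Ok x → j ≤ a x → Shift Ok j a r f g x
  shift-iterate lowering zero ok _ = shift ok refl refl refl
  shift-iterate {a} {r} {f} {g} lowering (suc j) {x} ok j<a =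
    shift (Shift.ok last) a-fall (trans (Shift.r-rise last) (cong suc (Shift.r-rise previous)))
          (trans (cong (λ z → iterate g z j) (Shift.undo last)) (Shift.undo previous))
    where
      previous = shift-iterate lowering j ok (<⇒≤ j<a)
      y = fold x f j
      last = lowering (Shift.ok previous)
                      (+-cancelˡ-≤ j 1 (a y) (subst₂ _≤_ (+-comm 1 j) (sym (Shift.a-fall previous)) j<a))
      a-fall : suc j + a (f y) ≡ a x
      a-fall = trans (sym (+-suc j (a (f y)))) (trans (cong (j +_) (Shift.a-fall last)) (Shift.a-fall previous))

  exchanges-via : ∀ {a r h x} y → h x ≡ y → Ok y → a y ≡ r x → r y ≡ a x → h y ≡ x → Exchanges Ok a r h x
  exchanges-via y refl ok a-y r-y back = exchanges ok a-y r-y back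

  shift-swaps : ∀ {a r f g x} → r x ≤ a x → (S : Shift Ok (a x ∸ r x) a r f g x) →
                  a (fold x f (a x ∸ r x)) ≡ r x × r (fold x f (a x ∸ r x)) ≡ a x
  shift-swaps {a} {r} {x = x} r≤a S =
      +-cancelˡ-≡ (a x ∸ r x) _ _ (trans (Shift.a-fall S) (sym (m∸n+n≡m r≤a)))
    , trans (Shift.r-rise S) (m∸n+n≡m r≤a)

  exchange-spec : ∀ {a r f g} → IsLowering Ok a r f g → IsLowering Ok r a g f →
                  ∀ {x} → Ok x → Exchanges Ok a r (exchange a r f g) x
  exchange-spec {a} {r} {f} {g} lowering raising {x} ok = by-cases (<-cmp (r x) (a x))
    where
      open ExchangeCases a r f g

      by-cases : Tri (r x < a x) (r x ≡ a x) (a x < r x) → Exchanges Ok a r (exchange a r f g) x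
      by-cases (tri≈ _ r≡a _) = exchanges-via x (exchange-≡ x r≡a) ok (sym r≡a) r≡a (exchange-≡ x r≡a)
      by-cases (tri< r<a _ _) = exchanges-via y (exchange-< x r<a) (Shift.ok S) a-y r-y back
        where
          d = a x ∸ r x
          S = shift-iterate lowering d ok (m∸n≤m (a x) (r x))
          y = fold x f d
          a-y = proj₁ (shift-swaps (<⇒≤ r<a) S)
          r-y = proj₂ (shift-swaps (<⇒≤ r<a) S)
          back : exchange a r f g y ≡ x
          back = begin
            exchange a r f g y   ≡⟨ exchange-> y (subst₂ _<_ (sym a-y) (sym r-y) r<a) ⟩
            fold y g (r y ∸ a y) ≡⟨ cong (fold y g) (cong₂ _∸_ r-y a-y) ⟩
            fold y g d           ≡⟨ iterate-is-fold y g d ⟩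
            iterate g y d        ≡⟨ Shift.undo S ⟩
            x                    ∎
      by-cases (tri> _ _ a<r) = exchanges-via y (exchange-> x a<r) (Shift.ok S) a-y r-y back
        where
          d = r x ∸ a x
          S = shift-iterate raising d ok (m∸n≤m (r x) (a x))
          y = fold x g d
          r-y = proj₁ (shift-swaps (<⇒≤ a<r) S)
          a-y = proj₂ (shift-swaps (<⇒≤ a<r) S)
          back : exchange a r f g y ≡ x
          back = begin
            exchange a r f g y   ≡⟨ exchange-< y (subst₂ _<_ (sym r-y) (sym a-y) a<r) ⟩
            fold y f (a y ∸ r y) ≡⟨ cong (fold y f) (cong₂ _∸_ a-y r-y) ⟩
            fold y f d           ≡⟨ iterate-is-fold y f d ⟩
            iterate f y d        ≡⟨ Shift.undo S ⟩
            x                    ∎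

module _ {n : ℕ} .{{_ : NonZero n}} where

  m≤o/n⇒m*n≤o : ∀ {m o} → m ≤ o / n → m * n ≤ o
  m≤o/n⇒m*n≤o {m} {o} m≤ = ≤-trans (*-monoˡ-≤ n m≤) (m/n*n≤m o n)

  m*n≤o⇒m≤o/n : ∀ {m o} → m * n ≤ o → m ≤ o / n
  m*n≤o⇒m≤o/n {m} {o} m*n≤ = subst (_≤ o / n) (m*n/n≡m m n) (/-monoˡ-≤ n m*n≤)

  m≡o/n⇒o<n+m*n : ∀ {m o} → m ≡ o / n → o < n + m * n
  m≡o/n⇒o<n+m*n {o = o} refl = subst (_< n + o / n * n) (sym (m≡m%n+[m/n]*n o n)) (+-monoˡ-< (o / n * n) (m%n<n o n))

  o<n+m*n⇒m≡o/n : ∀ {m o} → m ≤ o / n → o < n + m * n → m ≡ o / n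
  o<n+m*n⇒m≡o/n m≤ o< = ≤-antisym m≤ (≮⇒≥ (λ m< → <⇒≱ o< (m≤o/n⇒m*n≤o m<)))

module Ceilings (k : ℕ) (0<k : 0 < k) where
  open ≡-Reasoning

  data Admissible : ℕ → List ℕ → List ℕ → Set where
    []   : ∀ {b} → Admissible b [] []
    cons : ∀ {b v c cs vs} → b < v → v ≤ c → Admissible v cs vs → Admissible b (c ∷ cs) (v ∷ vs)

  data Spaced : ℕ → List ℕ → Set where
    []   : ∀ {lo} → Spaced lo []
    cons : ∀ {lo c cs} → lo ≤ c → Spaced (c + k) cs → Spaced lo (c ∷ cs)

  touches : List ℕ → List ℕ → ℕ
  touches (c ∷ cs) (v ∷ vs) with v ≟ c
  ... | yes _ = suc (touches cs vs)
  ... | no _  = touches cs vs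
  touches _ _ = 0

  run : ℕ → List ℕ → ℕ
  run τ []       = 0
  run τ (v ∷ vs) with <-cmp v τ
  ... | tri< _ _ _ = run τ vs
  ... | tri≈ _ _ _ = suc (run (τ + k) vs)
  ... | tri> _ _ _ = 0

  shiftDown : ℕ → List ℕ → List ℕ
  shiftDown τ []       = []
  shiftDown τ (v ∷ vs) with v ≤? τ + k
  ... | yes _ = pred v ∷ shiftDown τ vs
  ... | no _  = v ∷ vs

  shiftUp : ℕ → List ℕ → List ℕ
  shiftUp τ []       = []
  shiftUp τ (v ∷ vs) with v <? τ + k
  ... | yes _ = suc v ∷ shiftUp τ vs
  ... | no _  = v ∷ vs

  -- Lowering trades one touch for one more step of the run from τ: the first entry v > τ
  -- becomes τ (if v was not a touch, the tail is lowered from v + 1 first, which puts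
  -- v + 1 in front), and shiftDown then moves the entries up to τ + k down by one so
  -- that the run stops right after τ.
  lower : ℕ → List ℕ → List ℕ → List ℕ
  lower τ []       vs       = vs
  lower τ (c ∷ cs) []       = []
  lower τ (c ∷ cs) (v ∷ vs) with <-cmp v τ
  ... | tri< _ _ _ = v ∷ lower τ cs vs
  ... | tri≈ _ _ _ = τ ∷ lower (τ + k) cs vs
  ... | tri> _ _ _ with v ≟ c
  ...   | yes _ = τ ∷ shiftDown τ vs
  ...   | no _  = τ ∷ shiftDown τ (lower (suc v) cs vs)

  raise : ℕ → List ℕ → List ℕ → List ℕ
  raise τ []       vs       = vs
  raise τ (c ∷ cs) []       = []
  raise τ (c ∷ cs) (v ∷ vs) with <-cmp v τ
  ... | tri< _ _ _ = v ∷ raise τ cs vs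
  ... | tri> _ _ _ = v ∷ vs
  ... | tri≈ _ _ _ with run (τ + k) vs
  ...   | suc _ = τ ∷ raise (τ + k) cs vs
  ...   | zero with shiftUp τ vs
  ...     | []      = c ∷ []
  ...     | z ∷ vs′ with c <? z
  ...       | yes _ = c ∷ z ∷ vs′
  ...       | no _  = pred z ∷ raise z cs (z ∷ vs′)

  touches-≡ : ∀ c cs vs → touches (c ∷ cs) (c ∷ vs) ≡ suc (touches cs vs)
  touches-≡ c _ _ with c ≟ c
  ... | yes _  = refl
  ... | no c≢c = contradiction refl c≢c

  touches-≢ : ∀ {v c cs vs} → v ≢ c → touches (c ∷ cs) (v ∷ vs) ≡ touches cs vs
  touches-≢ {v} {c} v≢c with v ≟ c
  ... | yes v≡c = contradiction v≡c v≢c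
  ... | no _    = refl

  run-< : ∀ {τ v vs} → v < τ → run τ (v ∷ vs) ≡ run τ vs
  run-< {τ} {v} v<τ with <-cmp v τ
  ... | tri< _ _ _   = refl
  ... | tri≈ v≮τ _ _ = contradiction v<τ v≮τ
  ... | tri> v≮τ _ _ = contradiction v<τ v≮τ

  run-≡ : ∀ τ vs → run τ (τ ∷ vs) ≡ suc (run (τ + k) vs)
  run-≡ τ _ with <-cmp τ τ
  ... | tri< _ τ≢τ _ = contradiction refl τ≢τ
  ... | tri≈ _ _ _   = refl
  ... | tri> _ τ≢τ _ = contradiction refl τ≢τ

  run-> : ∀ {τ v vs} → τ < v → run τ (v ∷ vs) ≡ 0
  run-> {τ} {v} τ<v with <-cmp v τ
  ... | tri< _ _ τ≮v = contradiction τ<v τ≮v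
  ... | tri≈ _ _ τ≮v = contradiction τ<v τ≮v
  ... | tri> _ _ _   = refl

  shiftDown-≤ : ∀ {τ v vs} → v ≤ τ + k → shiftDown τ (v ∷ vs) ≡ pred v ∷ shiftDown τ vs
  shiftDown-≤ {τ} {v} v≤ with v ≤? τ + k
  ... | yes _ = refl
  ... | no v≰ = contradiction v≤ v≰

  shiftDown-> : ∀ {τ v vs} → τ + k < v → shiftDown τ (v ∷ vs) ≡ v ∷ vs
  shiftDown-> {τ} {v} >v with v ≤? τ + k
  ... | yes v≤ = contradiction v≤ (<⇒≱ >v)
  ... | no _   = refl

  shiftUp-< : ∀ {τ v vs} → v < τ + k → shiftUp τ (v ∷ vs) ≡ suc v ∷ shiftUp τ vs
  shiftUp-< {τ} {v} v< with v <? τ + k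
  ... | yes _ = refl
  ... | no v≮ = contradiction v< v≮

  shiftUp-≥ : ∀ {τ v vs} → τ + k ≤ v → shiftUp τ (v ∷ vs) ≡ v ∷ vs
  shiftUp-≥ {τ} {v} ≤v with v <? τ + k
  ... | yes v< = contradiction v< (≤⇒≯ ≤v)
  ... | no _   = refl

  lower-< : ∀ {τ v c cs vs} → v < τ → lower τ (c ∷ cs) (v ∷ vs) ≡ v ∷ lower τ cs vs
  lower-< {τ} {v} v<τ with <-cmp v τ
  ... | tri< _ _ _   = refl
  ... | tri≈ v≮τ _ _ = contradiction v<τ v≮τ
  ... | tri> v≮τ _ _ = contradiction v<τ v≮τ

  lower-≡ : ∀ {τ c cs vs} → lower τ (c ∷ cs) (τ ∷ vs) ≡ τ ∷ lower (τ + k) cs vs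
  lower-≡ {τ} with <-cmp τ τ
  ... | tri< _ τ≢τ _ = contradiction refl τ≢τ
  ... | tri≈ _ _ _   = refl
  ... | tri> _ τ≢τ _ = contradiction refl τ≢τ

  lower-touch : ∀ {τ c cs vs} → τ < c → lower τ (c ∷ cs) (c ∷ vs) ≡ τ ∷ shiftDown τ vs
  lower-touch {τ} {c} τ<c with <-cmp c τ
  ... | tri< _ _ τ≮c = contradiction τ<c τ≮c
  ... | tri≈ _ _ τ≮c = contradiction τ<c τ≮c
  ... | tri> _ _ _ with c ≟ c
  ...   | yes _  = refl
  ...   | no c≢c = contradiction refl c≢c

  lower-free : ∀ {τ v c cs vs} → τ < v → v ≢ c →
               lower τ (c ∷ cs) (v ∷ vs) ≡ τ ∷ shiftDown τ (lower (suc v) cs vs)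
  lower-free {τ} {v} {c} τ<v v≢c with <-cmp v τ
  ... | tri< _ _ τ≮v = contradiction τ<v τ≮v
  ... | tri≈ _ _ τ≮v = contradiction τ<v τ≮v
  ... | tri> _ _ _ with v ≟ c
  ...   | yes v≡c = contradiction v≡c v≢c
  ...   | no _    = refl

  raise-< : ∀ {τ v c cs vs} → v < τ → raise τ (c ∷ cs) (v ∷ vs) ≡ v ∷ raise τ cs vs
  raise-< {τ} {v} v<τ with <-cmp v τ
  ... | tri< _ _ _   = refl
  ... | tri≈ v≮τ _ _ = contradiction v<τ v≮τ
  ... | tri> v≮τ _ _ = contradiction v<τ v≮τ

  raise-run : ∀ {τ c cs vs r} → run (τ + k) vs ≡ suc r →
              raise τ (c ∷ cs) (τ ∷ vs) ≡ τ ∷ raise (τ + k) cs vs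
  raise-run {τ} run≡ with <-cmp τ τ
  ... | tri< _ τ≢τ _ = contradiction refl τ≢τ
  ... | tri> _ τ≢τ _ = contradiction refl τ≢τ
  ... | tri≈ _ _ _ rewrite run≡ = refl

  raise-end : ∀ {τ c cs} → raise τ (c ∷ cs) (τ ∷ []) ≡ c ∷ []
  raise-end {τ} with <-cmp τ τ
  ... | tri< _ τ≢τ _ = contradiction refl τ≢τ
  ... | tri> _ τ≢τ _ = contradiction refl τ≢τ
  ... | tri≈ _ _ _   = refl

  raise-touch : ∀ {τ c cs vs z vs′} → run (τ + k) vs ≡ 0 → shiftUp τ vs ≡ z ∷ vs′ → c < z →
                raise τ (c ∷ cs) (τ ∷ vs) ≡ c ∷ z ∷ vs′
  raise-touch {τ} {c} {z = z} run≡ up≡ c<z with <-cmp τ τ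
  ... | tri< _ τ≢τ _ = contradiction refl τ≢τ
  ... | tri> _ τ≢τ _ = contradiction refl τ≢τ
  ... | tri≈ _ _ _ rewrite run≡ | up≡ with c <? z
  ...   | yes _ = refl
  ...   | no c≮z = contradiction c<z c≮z

  raise-free : ∀ {τ c cs vs z vs′} → run (τ + k) vs ≡ 0 → shiftUp τ vs ≡ z ∷ vs′ → ¬ c < z →
               raise τ (c ∷ cs) (τ ∷ vs) ≡ pred z ∷ raise z cs (z ∷ vs′)
  raise-free {τ} {c} {z = z} run≡ up≡ c≮z with <-cmp τ τ
  ... | tri< _ τ≢τ _ = contradiction refl τ≢τ
  ... | tri> _ τ≢τ _ = contradiction refl τ≢τ
  ... | tri≈ _ _ _ rewrite run≡ | up≡ with c <? z
  ...   | yes c<z = contradiction c<z c≮z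
  ...   | no _    = refl

  Admissible-weaken : ∀ {b b′ cs vs} → b′ ≤ b → Admissible b cs vs → Admissible b′ cs vs
  Admissible-weaken b′≤b []                  = []
  Admissible-weaken b′≤b (cons b<v v≤c adm) = cons (≤-<-trans b′≤b b<v) v≤c adm

  Admissible-rebase : ∀ {b b′ cs v vs} → b′ < v → Admissible b cs (v ∷ vs) → Admissible b′ cs (v ∷ vs)
  Admissible-rebase b′<v (cons _ v≤c adm) = cons b′<v v≤c adm

  Spaced-weaken : ∀ {lo lo′ cs} → lo′ ≤ lo → Spaced lo cs → Spaced lo′ cs
  Spaced-weaken lo′≤lo []                   = []
  Spaced-weaken lo′≤lo (cons lo≤c spaced) = cons (≤-trans lo′≤lo lo≤c) spaced

  Spaced-all : ∀ {lo cs} → Spaced lo cs → All (lo ≤_) cs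
  Spaced-all []                           = []
  Spaced-all {lo} (cons {c = c} lo≤c spaced) =
    lo≤c ∷ All.map (≤-trans (≤-trans lo≤c (m≤m+n c k))) (Spaced-all spaced)

  Spaced-beyond : ∀ {τ c cs} → τ < c → Spaced (c + k) cs → All (τ + k <_) cs
  Spaced-beyond τ<c spaced = Spaced-all (Spaced-weaken (+-monoˡ-≤ k τ<c) spaced)

  τ<τ+k : ∀ τ → τ < τ + k
  τ<τ+k τ = m<m+n τ 0<k

  run-head : ∀ {b cs vs r} → Admissible b cs vs → run (suc b) vs ≡ suc r → Σ (List ℕ) λ vs′ → vs ≡ suc b ∷ vs′
  run-head {b} (cons {v = v} b<v _ _) run≡ with <-cmp v (suc b)
  ... | tri< v<1+b _ _ = contradiction b<v (≤⇒≯ (≤-pred v<1+b))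
  ... | tri≈ _ refl _  = _ , refl
  ... | tri> _ _ _     = contradiction run≡ λ ()

  shiftDown-admissible : ∀ {τ b cs vs} → τ < b → All (τ + k <_) cs → Admissible b cs vs →
                         Admissible (pred b) cs (shiftDown τ vs)
  shiftDown-admissible τ<b _ [] = []
  shiftDown-admissible {τ} {suc b} τ<b (k<c ∷ k<cs) (cons {v = suc v} b<v v≤c adm) with suc v ≤? τ + k
  ... | yes _ = cons (≤-pred b<v) (≤-trans (n≤1+n v) v≤c) (shiftDown-admissible (<-trans τ<b b<v) k<cs adm)
  ... | no _  = cons (<-trans (n<1+n b) b<v) v≤c adm

  run-shiftDown : ∀ {τ b cs vs} → τ < b → Admissible b cs vs → run (τ + k) (shiftDown τ vs) ≡ 0
  run-shiftDown τ<b [] = refl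
  run-shiftDown {τ} τ<b (cons {v = suc v} b<v _ adm) with suc v ≤? τ + k
  ... | yes v<τ+k = trans (run-< v<τ+k) (run-shiftDown (<-trans τ<b b<v) adm)
  ... | no v≮τ+k  = run-> (≰⇒> v≮τ+k)

  touches-shiftDown : ∀ {τ b cs vs} → τ < b → All (τ + k <_) cs → Admissible b cs vs →
                      touches cs (shiftDown τ vs) ≡ touches cs vs
  touches-shiftDown τ<b _ [] = refl
  touches-shiftDown {τ} τ<b (k<c ∷ k<cs) (cons {v = v} {c} {cs} {vs} b<v _ adm) with v ≤? τ + k
  ... | yes v≤ = begin
    touches (c ∷ cs) (pred v ∷ shiftDown τ vs) ≡⟨ touches-≢ (<⇒≢ (≤-<-trans pred[n]≤n v<c)) ⟩
    touches cs (shiftDown τ vs)                ≡⟨ touches-shiftDown (<-trans τ<b b<v) k<cs adm ⟩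
    touches cs vs                              ≡⟨ touches-≢ (<⇒≢ v<c) ⟨
    touches (c ∷ cs) (v ∷ vs)                  ∎
    where v<c = ≤-<-trans v≤ k<c
  ... | no _ = refl

  shiftUp-shiftDown : ∀ {τ b cs vs} → τ < b → Admissible b cs vs → shiftUp τ (shiftDown τ vs) ≡ vs
  shiftUp-shiftDown τ<b [] = refl
  shiftUp-shiftDown {τ} τ<b (cons {v = suc v} b<v _ adm) with suc v ≤? τ + k
  ... | yes v<τ+k = trans (shiftUp-< v<τ+k) (cong (suc v ∷_) (shiftUp-shiftDown (<-trans τ<b b<v) adm))
  ... | no v≰     = shiftUp-≥ (<⇒≤ (≰⇒> v≰))

  shiftUp-admissible : ∀ {τ b cs vs} → b < τ + k → All (τ + k <_) cs → run (τ + k) vs ≡ 0 →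
                       Admissible b cs vs → Admissible (suc b) cs (shiftUp τ vs)
  shiftUp-admissible _ _ _ [] = []
  shiftUp-admissible {τ} b< (k<c ∷ k<cs) run≡ (cons {v = v} b<v v≤c adm) with <-cmp v (τ + k)
  ... | tri< v< _ _ = subst (Admissible _ _) (sym (shiftUp-< v<))
                        (cons (s≤s b<v) (≤-trans v< (<⇒≤ k<c)) (shiftUp-admissible v< k<cs run≡ adm))
  ... | tri≈ _ refl _ = contradiction run≡ λ ()
  ... | tri> _ _ >v   = subst (Admissible _ _) (sym (shiftUp-≥ (<⇒≤ >v))) (cons (≤-<-trans b< >v) v≤c adm)

  touches-shiftUp : ∀ {τ b cs vs} → All (τ + k <_) cs → run (τ + k) vs ≡ 0 → Admissible b cs vs →
                    touches cs (shiftUp τ vs) ≡ touches cs vs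
  touches-shiftUp _ _ [] = refl
  touches-shiftUp {τ} (k<c ∷ k<cs) run≡ (cons {v = v} {c} {cs} {vs} _ _ adm) with <-cmp v (τ + k)
  ... | tri< v< _ _ = begin
    touches (c ∷ cs) (shiftUp τ (v ∷ vs))  ≡⟨ cong (touches (c ∷ cs)) (shiftUp-< v<) ⟩
    touches (c ∷ cs) (suc v ∷ shiftUp τ vs) ≡⟨ touches-≢ (<⇒≢ (≤-<-trans v< k<c)) ⟩
    touches cs (shiftUp τ vs)               ≡⟨ touches-shiftUp k<cs run≡ adm ⟩
    touches cs vs                           ≡⟨ touches-≢ (<⇒≢ (<-trans v< k<c)) ⟨
    touches (c ∷ cs) (v ∷ vs)               ∎
  ... | tri≈ _ refl _ = contradiction run≡ λ ()
  ... | tri> _ _ >v   = cong (touches (c ∷ cs)) (shiftUp-≥ (<⇒≤ >v))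

  shiftDown-shiftUp : ∀ {τ b cs vs} → run (τ + k) vs ≡ 0 → Admissible b cs vs → shiftDown τ (shiftUp τ vs) ≡ vs
  shiftDown-shiftUp _ [] = refl
  shiftDown-shiftUp {τ} run≡ (cons {v = v} _ _ adm) with <-cmp v (τ + k)
  ... | tri< v< _ _   = trans (cong (shiftDown τ) (shiftUp-< v<))
                          (trans (shiftDown-≤ v<) (cong (v ∷_) (shiftDown-shiftUp run≡ adm)))
  ... | tri≈ _ refl _ = contradiction run≡ λ ()
  ... | tri> _ _ >v   = trans (cong (shiftDown τ) (shiftUp-≥ (<⇒≤ >v))) (shiftDown-> >v)

  shiftUp-∷ : ∀ τ v vs → Σ ℕ λ z → Σ (List ℕ) λ vs′ → shiftUp τ (v ∷ vs) ≡ z ∷ vs′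
  shiftUp-∷ τ v vs with v <? τ + k
  ... | yes _ = suc v , shiftUp τ vs , refl
  ... | no _  = v , vs , refl

  raise-lower-touch : ∀ {τ v cs vs} → τ < v → Admissible v cs vs → raise τ (v ∷ cs) (τ ∷ shiftDown τ vs) ≡ v ∷ vs
  raise-lower-touch {τ} {v} {cs} τ<v [] = raise-end {τ} {v} {cs}
  raise-lower-touch {τ} {v} {cs} {vs} τ<v adm@(cons v<z _ _) =
    raise-touch {τ} {v} {cs} {shiftDown τ vs} (run-shiftDown ≤-refl adm↑) (shiftUp-shiftDown ≤-refl adm↑) v<z
    where adm↑ = Admissible-weaken τ<v adm

  LowerStep RaiseStep : ℕ → ℕ → List ℕ → List ℕ → Set
  LowerStep b τ cs = Shift (Admissible b cs) 1 (touches cs) (run τ) (lower τ cs) (raise τ cs)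
  RaiseStep b τ cs = Shift (Admissible b cs) 1 (run τ) (touches cs) (raise τ cs) (lower τ cs)

  Lowering Raising : List ℕ → Set
  Lowering cs = ∀ {b τ} → b < τ → Spaced (suc τ) cs →
                IsLowering (Admissible b cs) (touches cs) (run τ) (lower τ cs) (raise τ cs)
  Raising cs  = ∀ {b τ} → b < τ → Spaced (suc τ) cs →
                IsLowering (Admissible b cs) (run τ) (touches cs) (raise τ cs) (lower τ cs)

  lower-above : ∀ {b τ c cs v vs} → Lowering cs → b < τ → Spaced (suc τ) (c ∷ cs) → τ < v → v ≤ c →
                Admissible v cs vs → 1 ≤ touches (c ∷ cs) (v ∷ vs) → LowerStep b τ (c ∷ cs) (v ∷ vs)
  lower-above {b} {τ} {c} {cs} {v} {vs} lower-spec b<τ (cons τ<c spaced) τ<v v≤c adm touched with v ≟ c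
  ... | yes refl =
    shift-via (τ ∷ shiftDown τ vs) (lower-touch τ<v) (cons b<τ (<⇒≤ τ<v) (shiftDown-admissible ≤-refl beyond adm↑))
      (trans (cong suc (trans (touches-≢ (<⇒≢ τ<v)) (touches-shiftDown ≤-refl beyond adm↑))) (sym (touches-≡ v cs vs)))
      (trans (run-≡ τ (shiftDown τ vs)) (cong suc (trans (run-shiftDown ≤-refl adm↑) (sym (run-> τ<v)))))
      (raise-lower-touch τ<v adm)
    where
      adm↑ = Admissible-weaken τ<v adm
      beyond = Spaced-beyond τ<v spaced
  ... | no v≢c =
    shift-via (τ ∷ shiftDown τ u) (lower-free τ<v v≢c) (cons b<τ (<⇒≤ τ<c) (shiftDown-admissible ≤-refl beyond adm↑))
      (trans (cong suc (trans (touches-≢ (<⇒≢ τ<c)) (touches-shiftDown ≤-refl beyond adm↑)))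
             (trans a-fall (sym (touches-≢ v≢c))))
      (trans (run-≡ τ (shiftDown τ u)) (cong suc (trans (run-shiftDown ≤-refl adm↑) (sym (run-> τ<v)))))
      undo′
    where
      v<c = ≤∧≢⇒< v≤c v≢c
      u = lower (suc v) cs vs
      open Shift (lower-spec ≤-refl (Spaced-weaken (≤-trans (s≤s v<c) (τ<τ+k c)) spaced) adm touched)
      adm↑ = Admissible-weaken τ<v ok
      beyond = Spaced-beyond τ<c spaced
      u≡ = proj₂ (run-head ok r-rise)
      undo′ : raise τ (c ∷ cs) (τ ∷ shiftDown τ u) ≡ v ∷ vs
      undo′ = begin
        raise τ (c ∷ cs) (τ ∷ shiftDown τ u)   ≡⟨ raise-free {vs = shiftDown τ u} (run-shiftDown ≤-refl adm↑)
                                                    (trans (shiftUp-shiftDown ≤-refl adm↑) u≡) (≤⇒≯ v<c) ⟩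
        v ∷ raise (suc v) cs (suc v ∷ _)       ≡⟨ cong (λ u′ → v ∷ raise (suc v) cs u′) u≡ ⟨
        v ∷ raise (suc v) cs u                 ≡⟨ cong (v ∷_) undo ⟩
        v ∷ vs                                 ∎

  lower-spec : ∀ {cs} → Lowering cs
  lower-spec _ _ [] ()
  lower-spec {c ∷ cs} {b} {τ} b<τ spaced₀@(cons τ<c spaced) {v ∷ vs} (cons b<v v≤c adm) touched with <-cmp v τ
  ... | tri< v<τ _ _ =
    shift-via (v ∷ lower τ cs vs) (lower-< v<τ) (cons b<v v≤c ok)
      (trans (cong suc (touches-≢ v≢c)) (trans a-fall (sym (touches-≢ v≢c))))
      (trans (run-< v<τ) (trans r-rise (cong suc (sym (run-< v<τ)))))
      (trans (raise-< v<τ) (cong (v ∷_) undo))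
    where
      v≢c = <⇒≢ (<-trans v<τ τ<c)
      open Shift (lower-spec v<τ (Spaced-weaken (≤-trans τ<c (m≤m+n c k)) spaced) adm
                             (subst (1 ≤_) (touches-≢ v≢c) touched))
  ... | tri≈ _ refl _ =
    shift-via (v ∷ lower (v + k) cs vs) lower-≡ (cons b<τ (<⇒≤ τ<c) ok)
      (trans (cong suc (touches-≢ v≢c)) (trans a-fall (sym (touches-≢ v≢c))))
      (trans (run-≡ v _) (cong suc (trans r-rise (sym (run-≡ v vs)))))
      (trans (raise-run r-rise) (cong (v ∷_) undo))
    where
      v≢c = <⇒≢ τ<c
      open Shift (lower-spec (τ<τ+k v) (Spaced-weaken (+-monoˡ-≤ k τ<c) spaced) adm
                             (subst (1 ≤_) (touches-≢ v≢c) touched))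
  ... | tri> _ _ τ<v = lower-above lower-spec b<τ spaced₀ τ<v v≤c adm touched

  -- The run from τ stops right after τ: undo the shiftDown, then the new head z tells
  -- whether the entry replaced by τ was the touch c (when c < z) or was lowered from z.
  raise-last : ∀ {b τ c cs w z w′} → Raising cs → b < τ → τ < c → Spaced (c + k) cs → Admissible τ cs w →
               run (τ + k) w ≡ 0 → shiftUp τ w ≡ z ∷ w′ → Admissible (suc τ) cs (z ∷ w′) →
               RaiseStep b τ (c ∷ cs) (τ ∷ w)
  raise-last {b} {τ} {c} {cs} {w} {suc x} {w′} raise-spec b<τ τ<c spaced adm run≡ up≡ adm↑@(cons (s≤s τ<x) _ _) =
    by-cases (c <? suc x)
    where
      beyond = Spaced-beyond τ<c spaced
      run-τ∷w : run τ (τ ∷ w) ≡ 1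
      run-τ∷w = trans (run-≡ τ w) (cong suc run≡)
      touches-up : touches cs (suc x ∷ w′) ≡ touches (c ∷ cs) (τ ∷ w)
      touches-up = trans (cong (touches cs) (sym up≡)) (trans (touches-shiftUp beyond run≡ adm) (sym (touches-≢ (<⇒≢ τ<c))))
      down-up : shiftDown τ (suc x ∷ w′) ≡ w
      down-up = trans (cong (shiftDown τ) (sym up≡)) (shiftDown-shiftUp run≡ adm)

      by-cases : Dec (c < suc x) → RaiseStep b τ (c ∷ cs) (τ ∷ w)
      by-cases (yes c<z) =
        shift-via (c ∷ suc x ∷ w′) (raise-touch {τ} {c} {cs} {w} run≡ up≡ c<z)
          (cons (<-trans b<τ τ<c) ≤-refl (Admissible-rebase c<z adm↑))
          (trans (cong suc (run-> τ<c)) (sym run-τ∷w))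
          (trans (touches-≡ c cs (suc x ∷ w′)) (cong suc touches-up))
          (trans (lower-touch τ<c) (cong (τ ∷_) down-up))
      by-cases (no c≮z) =
        shift-via (x ∷ raise (suc x) cs (suc x ∷ w′)) (raise-free {τ} {c} {cs} {w} run≡ up≡ c≮z)
          (cons (<-trans b<τ τ<x) (<⇒≤ x<c) ok)
          (trans (cong suc (run-> τ<x)) (sym run-τ∷w))
          (trans (touches-≢ (<⇒≢ x<c)) (trans r-rise (cong suc touches-up)))
          (trans (lower-free τ<x (<⇒≢ x<c)) (cong (τ ∷_) (trans (cong (shiftDown τ) undo) down-up)))
        where
          x<c = ≮⇒≥ c≮z
          open Shift (raise-spec ≤-refl (Spaced-weaken (≤-trans (s≤s x<c) (τ<τ+k c)) spaced)
                                 (Admissible-rebase ≤-refl adm↑) (subst (1 ≤_) (sym (run-≡ (suc x) w′)) (s≤s z≤n)))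

  raise-spec : ∀ {cs} → Raising cs
  raise-spec _ _ [] ()
  raise-spec {c ∷ cs} {b} {τ} b<τ (cons τ<c spaced) {y ∷ w} (cons b<y y≤c adm) running with <-cmp y τ
  ... | tri< y<τ _ _ =
    shift-via (y ∷ raise τ cs w) (raise-< y<τ) (cons b<y y≤c ok)
      (trans (cong suc (run-< y<τ)) (trans a-fall (sym (run-< y<τ))))
      (trans (touches-≢ y≢c) (trans r-rise (cong suc (sym (touches-≢ y≢c)))))
      (trans (lower-< y<τ) (cong (y ∷_) undo))
    where
      y≢c = <⇒≢ (<-trans y<τ τ<c)
      open Shift (raise-spec y<τ (Spaced-weaken (≤-trans τ<c (m≤m+n c k)) spaced) adm running)
  ... | tri> _ _ τ<y = contradiction running λ ()
  ... | tri≈ _ refl _ with run (y + k) w in run≡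
  ...   | suc _ =
    shift-via (y ∷ raise (y + k) cs w) (raise-run run≡) (cons b<τ (<⇒≤ τ<c) ok)
      (trans (cong suc (run-≡ y _)) (trans (cong suc a-fall) (sym (run-≡ y w))))
      (trans (touches-≢ y≢c) (trans r-rise (cong suc (sym (touches-≢ y≢c)))))
      (trans lower-≡ (cong (y ∷_) undo))
    where
      y≢c = <⇒≢ τ<c
      open Shift (raise-spec (τ<τ+k y) (Spaced-weaken (+-monoˡ-≤ k τ<c) spaced) adm
                             (subst (1 ≤_) (sym run≡) (s≤s z≤n)))
  ...   | zero with w | adm
  ...     | [] | [] =
    shift-via (c ∷ []) (raise-end {y} {c} {[]}) (cons (<-trans b<τ τ<c) ≤-refl [])
      (trans (cong suc (run-> τ<c)) (sym (run-≡ y [])))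
      (trans (touches-≡ c [] []) (cong suc (sym (touches-≢ (<⇒≢ τ<c)))))
      (lower-touch τ<c)
  ...     | v ∷ vs | adm′ = raise-last raise-spec b<τ τ<c spaced adm′ run≡ up≡ (subst (Admissible (suc y) cs) up≡ adm↑)
    where
      up≡ = proj₂ (proj₂ (shiftUp-∷ y v vs))
      adm↑ = shiftUp-admissible (τ<τ+k y) (Spaced-beyond τ<c spaced) run≡ adm′

  -- An entry equal to a ceiling τ is at once a touch and a step of the run from τ, so it
  -- is kept; lowering is only available while τ stays strictly below the ceilings.
  swap : ℕ → List ℕ → List ℕ → List ℕ
  swap τ []       vs       = vs
  swap τ (c ∷ cs) []       = []
  swap τ (c ∷ cs) (v ∷ vs) with τ ≟ c
  ... | no _  = exchange (touches (c ∷ cs)) (run τ) (lower τ (c ∷ cs)) (raise τ (c ∷ cs)) (v ∷ vs)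
  ... | yes _ with <-cmp v τ
  ...   | tri< _ _ _ = v ∷ swap τ cs vs
  ...   | tri≈ _ _ _ = τ ∷ swap (τ + k) cs vs
  ...   | tri> _ _ _ = v ∷ vs

  swap-≢ : ∀ {b τ c cs vs} → τ ≢ c → Admissible b (c ∷ cs) vs →
           swap τ (c ∷ cs) vs ≡ exchange (touches (c ∷ cs)) (run τ) (lower τ (c ∷ cs)) (raise τ (c ∷ cs)) vs
  swap-≢ {τ = τ} {c} τ≢c (cons _ _ _) with τ ≟ c
  ... | yes τ≡c = contradiction τ≡c τ≢c
  ... | no _    = refl

  swap-< : ∀ {τ v cs vs} → v < τ → swap τ (τ ∷ cs) (v ∷ vs) ≡ v ∷ swap τ cs vs
  swap-< {τ} {v} v<τ with τ ≟ τ
  ... | no τ≢τ = contradiction refl τ≢τ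
  ... | yes _ with <-cmp v τ
  ...   | tri< _ _ _   = refl
  ...   | tri≈ v≮τ _ _ = contradiction v<τ v≮τ
  ...   | tri> v≮τ _ _ = contradiction v<τ v≮τ

  swap-≡ : ∀ τ cs vs → swap τ (τ ∷ cs) (τ ∷ vs) ≡ τ ∷ swap (τ + k) cs vs
  swap-≡ τ _ _ with τ ≟ τ
  ... | no τ≢τ = contradiction refl τ≢τ
  ... | yes _ with <-cmp τ τ
  ...   | tri< _ τ≢τ _ = contradiction refl τ≢τ
  ...   | tri≈ _ _ _   = refl
  ...   | tri> _ τ≢τ _ = contradiction refl τ≢τ

  swap-spec : ∀ {b τ cs vs} → b < τ → Spaced τ cs → Admissible b cs vs →
              Exchanges (Admissible b cs) (touches cs) (run τ) (swap τ cs) vs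
  swap-spec _ _ [] = exchanges [] refl refl refl
  swap-spec {b} {τ} {c ∷ cs} {v ∷ vs} b<τ (cons τ≤c spaced) adm₀@(cons b<v v≤c adm) with τ ≟ c
  ... | no τ≢c = exchanges-via _ (swap-≢ τ≢c adm₀) ok a-swap r-swap (trans (swap-≢ τ≢c ok) involutive)
    where
      spaced′ = cons (≤∧≢⇒< τ≤c τ≢c) spaced
      open Exchanges (exchange-spec (lower-spec b<τ spaced′) (raise-spec b<τ spaced′) adm₀)
  ... | yes refl with <-cmp v τ
  ...   | tri< v<τ _ _ =
    exchanges-via (v ∷ swap τ cs vs) (swap-< v<τ) (cons b<v v≤c ok)
      (trans (touches-≢ v≢τ) (trans a-swap (sym (run-< v<τ))))
      (trans (run-< v<τ) (trans r-swap (sym (touches-≢ v≢τ))))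
      (trans (swap-< v<τ) (cong (v ∷_) involutive))
    where
      v≢τ = <⇒≢ v<τ
      open Exchanges (swap-spec v<τ (Spaced-weaken (m≤m+n τ k) spaced) adm)
  ...   | tri≈ _ refl _ =
    exchanges-via (v ∷ swap (v + k) cs vs) (swap-≡ v cs vs) (cons b<v v≤c ok)
      (trans (touches-≡ v cs _) (trans (cong suc a-swap) (sym (run-≡ v vs))))
      (trans (run-≡ v _) (trans (cong suc r-swap) (sym (touches-≡ v cs vs))))
      (trans (swap-≡ v cs _) (cong (v ∷_) involutive))
    where
      open Exchanges (swap-spec (τ<τ+k v) spaced adm)
  ...   | tri> _ _ τ<v = contradiction v≤c (<⇒≱ τ<v)

  ∉-below : ∀ {b cs vs τ} → Admissible b cs vs → τ ≤ b → τ ∈ᵇ vs ≡ false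
  ∉-below [] _ = refl
  ∉-below {τ = τ} (cons {v = v} b<v _ adm) τ≤b =
    cong₂ _∨_ (dec-false (τ ≟ v) (<⇒≢ τ<v)) (∉-below adm (<⇒≤ τ<v))
    where τ<v = ≤-<-trans τ≤b b<v

  run-∈ᵇ : ∀ {b cs vs τ} → Admissible b cs vs → b < τ → run τ vs ≡ (if τ ∈ᵇ vs then suc (run (τ + k) vs) else 0)
  run-∈ᵇ [] _ = refl
  run-∈ᵇ {vs = v ∷ vs} {τ} adm₀@(cons b<v v≤c adm) b<τ with <-cmp v τ
  ... | tri< v<τ v≢τ _ =
    trans (run-∈ᵇ adm v<τ)
          (cong₂ (λ b r → if b then suc r else 0) (cong (_∨ τ ∈ᵇ vs) (sym (dec-false (τ ≟ v) (v≢τ ∘ sym))))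
                                                   (sym (run-< (<-≤-trans v<τ (m≤m+n τ k)))))
  ... | tri≈ _ refl _ =
    trans (cong suc (sym (run-< (τ<τ+k v))))
          (cong (λ b → if b ∨ v ∈ᵇ vs then suc (run (v + k) (v ∷ vs)) else 0) (sym (dec-true (v ≟ v) refl)))
  ... | tri> _ _ τ<v = cong (λ b → if b then suc (run (τ + k) (v ∷ vs)) else 0) (sym (∉-below (cons τ<v v≤c adm) ≤-refl))

  run-≤-length : ∀ τ vs → run τ vs ≤ length vs
  run-≤-length τ []       = z≤n
  run-≤-length τ (v ∷ vs) with <-cmp v τ
  ... | tri< _ _ _ = m≤n⇒m≤1+n (run-≤-length τ vs)
  ... | tri≈ _ _ _ = s≤s (run-≤-length (τ + k) vs)
  ... | tri> _ _ _ = z≤n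

  firstMissing-run : ∀ fuel i {b cs vs us} → Admissible b cs vs → b < k * i →
                     (∀ τ → b < τ → τ ∈ᵇ us ≡ τ ∈ᵇ vs) → run (k * i) vs < fuel →
                     firstMissing k us i fuel ≡ i + run (k * i) vs
  firstMissing-run (suc fuel) i {vs = vs} {us} adm b<ki agree run< =
    trans (cong (λ b → if b then firstMissing k us (suc i) fuel else i) (agree (k * i) b<ki)) (by-membership refl)
    where
      k[1+i]≡ki+k : k * suc i ≡ k * i + k
      k[1+i]≡ki+k = trans (*-suc k i) (+-comm k (k * i))
      by-membership : ∀ {found} → (k * i) ∈ᵇ vs ≡ found →
                      (if found then firstMissing k us (suc i) fuel else i) ≡ i + run (k * i) vs
      by-membership {true} mem = begin
        firstMissing k us (suc i) fuel    ≡⟨ firstMissing-run fuel (suc i) adm b<k[1+i] agree run<′ ⟩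
        suc i + run (k * suc i) vs        ≡⟨ cong (λ τ → suc i + run τ vs) k[1+i]≡ki+k ⟩
        suc i + run (k * i + k) vs        ≡⟨ +-suc i _ ⟨
        i + suc (run (k * i + k) vs)      ≡⟨ cong (i +_) run≡ ⟨
        i + run (k * i) vs                ∎
        where
          run≡ : run (k * i) vs ≡ suc (run (k * i + k) vs)
          run≡ = trans (run-∈ᵇ adm b<ki) (cong (λ b → if b then suc (run (k * i + k) vs) else 0) mem)
          b<k[1+i] = <-≤-trans b<ki (*-monoʳ-≤ k (n≤1+n i))
          run<′ : run (k * suc i) vs < fuel
          run<′ = subst (λ τ → run τ vs < fuel) (sym k[1+i]≡ki+k) (≤-pred (subst (_< suc fuel) run≡ run<))
      by-membership {false} mem =
        sym (trans (cong (i +_) (trans (run-∈ᵇ adm b<ki) (cong (λ b → if b then suc (run (k * i + k) vs) else 0) mem)))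
                   (+-identityʳ i))

module Lattice (m n : ℕ) where
  open ≡-Reasoning

  east north : ℕ → List Step
  east j  = replicate j E
  north j = replicate j N

  -- x-positions and lengths of the maximal runs of north steps, bottom to top
  Blocks : Set
  Blocks = List ℕ × List ℕ

  data WellFormed : ℕ → Blocks → Set where
    []   : ∀ {x} → WellFormed x ([] , [])
    cons : ∀ {x v s vs ss} → x ≤ v → 1 ≤ s → WellFormed (suc v) (vs , ss) → WellFormed x (v ∷ vs , s ∷ ss)

  consN : ℕ → Blocks → Blocks
  consN x (v ∷ vs , s ∷ ss) with v ≟ x
  ... | yes _ = x ∷ vs , suc s ∷ ss
  ... | no _  = x ∷ v ∷ vs , 1 ∷ s ∷ ss
  consN x (vs , ss) = x ∷ vs , 1 ∷ ss

  blocksFrom : ℕ → List Step → Blocks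
  blocksFrom x []      = [] , []
  blocksFrom x (E ∷ w) = blocksFrom (suc x) w
  blocksFrom x (N ∷ w) = consN x (blocksFrom x w)

  pathFrom : ℕ → Blocks → List Step
  pathFrom x (v ∷ vs , s ∷ ss) = east (v ∸ x) ++ north s ++ pathFrom v (vs , ss)
  pathFrom x _                 = east (m ∸ x)

  walk-east : ∀ {A : Set} (F : ℕ → List Step → A) → (∀ x w → F x (E ∷ w) ≡ F (suc x) w) →
              ∀ j x w → F x (east j ++ w) ≡ F (j + x) w
  walk-east F step zero    x w = refl
  walk-east F step (suc j) x w =
    trans (step x _) (trans (walk-east F step j (suc x) w) (cong (λ y → F y w) (+-suc j x)))

  walk-east-to : ∀ {A : Set} (F : ℕ → List Step → A) → (∀ x w → F x (E ∷ w) ≡ F (suc x) w) →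
                 ∀ {x v} w → x ≤ v → F x (east (v ∸ x) ++ w) ≡ F v w
  walk-east-to F step {x} {v} w x≤v = trans (walk-east F step (v ∸ x) x w) (cong (λ y → F y w) (m∸n+n≡m x≤v))

  walk-east-end : ∀ {A : Set} (F : ℕ → List Step → A) → (∀ x w → F x (E ∷ w) ≡ F (suc x) w) →
                  ∀ j x → F x (east j) ≡ F (j + x) []
  walk-east-end F step j x = trans (cong (F x) (sym (++-identityʳ (east j)))) (walk-east F step j x [])

  WellFormed-weaken : ∀ {x x′ bl} → x′ ≤ x → WellFormed x bl → WellFormed x′ bl
  WellFormed-weaken x′≤x []                = []
  WellFormed-weaken x′≤x (cons x≤v 1≤s wf) = cons (≤-trans x′≤x x≤v) 1≤s wf

  WellFormed-consN : ∀ {x bl} → WellFormed x bl → WellFormed x (consN x bl)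
  WellFormed-consN [] = cons ≤-refl ≤-refl []
  WellFormed-consN {x} (cons {v = v} x≤v 1≤s wf) with v ≟ x
  ... | yes refl = cons ≤-refl (s≤s z≤n) wf
  ... | no v≢x   = cons ≤-refl ≤-refl (cons (≤∧≢⇒< x≤v (v≢x ∘ sym)) 1≤s wf)

  WellFormed-blocksFrom : ∀ x w → WellFormed x (blocksFrom x w)
  WellFormed-blocksFrom x []      = []
  WellFormed-blocksFrom x (E ∷ w) = WellFormed-weaken (n≤1+n x) (WellFormed-blocksFrom (suc x) w)
  WellFormed-blocksFrom x (N ∷ w) = WellFormed-consN (WellFormed-blocksFrom x w)

  east-∸ : ∀ {x y} → x < y → east (y ∸ x) ≡ E ∷ east (y ∸ suc x)
  east-∸ {x} {suc y} (s≤s x≤y) = cong east (+-∸-assoc 1 x≤y)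

  pathFrom-E : ∀ x bl → WellFormed (suc x) bl → x < m →
               pathFrom x bl ≡ E ∷ pathFrom (suc x) bl
  pathFrom-E x ([] , []) [] x<m = east-∸ x<m
  pathFrom-E x (v ∷ vs , s ∷ ss) (cons x<v _ _) _ = cong (λ u → u ++ north s ++ pathFrom v (vs , ss)) (east-∸ x<v)

  pathFrom-consN : ∀ x bl → WellFormed x bl → pathFrom x (consN x bl) ≡ N ∷ pathFrom x bl
  pathFrom-consN x ([] , []) [] rewrite n∸n≡0 x = refl
  pathFrom-consN x (v ∷ vs , s ∷ ss) (cons _ _ _) with v ≟ x
  ... | yes refl rewrite n∸n≡0 x = refl
  ... | no _     rewrite n∸n≡0 x = refl

  pathFrom-blocksFrom : ∀ x w → #E w + x ≡ m → pathFrom x (blocksFrom x w) ≡ w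
  pathFrom-blocksFrom x [] x≡m = cong east (trans (cong (m ∸_) x≡m) (n∸n≡0 m))
  pathFrom-blocksFrom x (E ∷ w) e+x≡m = begin
    pathFrom x (blocksFrom (suc x) w)           ≡⟨ pathFrom-E x _ (WellFormed-blocksFrom (suc x) w) x<m ⟩
    E ∷ pathFrom (suc x) (blocksFrom (suc x) w) ≡⟨ cong (E ∷_) (pathFrom-blocksFrom (suc x) w (trans (+-suc _ x) e+x≡m)) ⟩
    E ∷ w                                       ∎
    where x<m = subst (x <_) e+x≡m (s≤s (m≤n+m x (#E w)))
  pathFrom-blocksFrom x (N ∷ w) e+x≡m =
    trans (pathFrom-consN x _ (WellFormed-blocksFrom x w)) (cong (N ∷_) (pathFrom-blocksFrom x w e+x≡m))

  consN-fresh : ∀ {x vs ss} → WellFormed (suc x) (vs , ss) → consN x (vs , ss) ≡ (x ∷ vs , 1 ∷ ss)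
  consN-fresh [] = refl
  consN-fresh {x} (cons {v = v} x<v _ _) with v ≟ x
  ... | yes refl = contradiction x<v (n≮n x)
  ... | no _     = refl

  consN-same : ∀ x vs s ss → consN x (x ∷ vs , s ∷ ss) ≡ (x ∷ vs , suc s ∷ ss)
  consN-same x _ _ _ with x ≟ x
  ... | yes _  = refl
  ... | no x≢x = contradiction refl x≢x

  blocksFrom-north : ∀ s v w {vs ss} → blocksFrom v w ≡ (vs , ss) → WellFormed (suc v) (vs , ss) →
                     blocksFrom v (north (suc s) ++ w) ≡ (v ∷ vs , suc s ∷ ss)
  blocksFrom-north zero    v w bl≡ wf = trans (cong (consN v) bl≡) (consN-fresh wf)
  blocksFrom-north (suc s) v w bl≡ wf = trans (cong (consN v) (blocksFrom-north s v w bl≡ wf)) (consN-same v _ _ _)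

  blocksFrom-pathFrom : ∀ {x bl} → WellFormed x bl → blocksFrom x (pathFrom x bl) ≡ bl
  blocksFrom-pathFrom {x} [] = walk-east-end blocksFrom (λ _ _ → refl) (m ∸ x) x
  blocksFrom-pathFrom {x} (cons {v = v} {vs = vs} {ss} x≤v (s≤s {n = s} z≤n) wf) = begin
    blocksFrom x (east (v ∸ x) ++ north (suc s) ++ pathFrom v (vs , ss))
      ≡⟨ walk-east-to blocksFrom (λ _ _ → refl) _ x≤v ⟩
    blocksFrom v (north (suc s) ++ pathFrom v (vs , ss))
      ≡⟨ blocksFrom-north s v _ (blocksFrom-pathFrom (WellFormed-weaken (n≤1+n v) wf)) wf ⟩
    (v ∷ vs , suc s ∷ ss) ∎

  #E-north : ∀ s w → #E (north s ++ w) ≡ #E w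
  #E-north zero    w = refl
  #E-north (suc s) w = #E-north s w

  #N-north : ∀ s w → #N (north s ++ w) ≡ s + #N w
  #N-north zero    w = refl
  #N-north (suc s) w = cong suc (#N-north s w)

  #E-pathFrom : ∀ {x bl} → WellFormed x bl → x ≤ m → All (_≤ m) (proj₁ bl) → #E (pathFrom x bl) + x ≡ m
  #E-pathFrom {x} [] x≤m _ = trans (walk-east-end F step (m ∸ x) x) (m∸n+n≡m x≤m)
    where
      F = λ x w → #E w + x
      step = λ x w → sym (+-suc (#E w) x)
  #E-pathFrom {x} (cons {v = v} {s} {vs} {ss} x≤v _ wf) _ (v≤m ∷ vs≤m) = begin
    #E (east (v ∸ x) ++ north s ++ pathFrom v (vs , ss)) + x ≡⟨ walk-east-to F step _ x≤v ⟩
    #E (north s ++ pathFrom v (vs , ss)) + v                 ≡⟨ cong (_+ v) (#E-north s _) ⟩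
    #E (pathFrom v (vs , ss)) + v                            ≡⟨ #E-pathFrom (WellFormed-weaken (n≤1+n v) wf) v≤m vs≤m ⟩
    m                                                        ∎
    where
      F = λ x w → #E w + x
      step = λ x w → sym (+-suc (#E w) x)

  #N-pathFrom : ∀ {x bl} → WellFormed x bl → #N (pathFrom x bl) ≡ sum (proj₂ bl)
  #N-pathFrom {x} [] = walk-east-end (λ _ → #N) (λ _ _ → refl) (m ∸ x) x
  #N-pathFrom {x} (cons {v = v} {s} x≤v _ wf) =
    trans (walk-east-to (λ _ → #N) (λ _ _ → refl) _ x≤v)
          (trans (#N-north s _) (cong (s +_) (#N-pathFrom (WellFormed-weaken (n≤1+n v) wf))))

  BeginsEast : List Step → Set
  BeginsEast (N ∷ _) = ⊥
  BeginsEast _       = ⊤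

  east-beginsEast : ∀ j w → BeginsEast w → BeginsEast (east j ++ w)
  east-beginsEast zero    w b = b
  east-beginsEast (suc j) w _ = tt

  pathFrom-beginsEast : ∀ {v bl} → WellFormed (suc v) bl → BeginsEast (pathFrom v bl)
  pathFrom-beginsEast {v} [] = subst BeginsEast (++-identityʳ (east (m ∸ v))) (east-beginsEast (m ∸ v) [] tt)
  pathFrom-beginsEast {v} (cons {v = v′} {s} {vs} {ss} v<v′ _ _) =
    subst (λ u → BeginsEast (u ++ north s ++ pathFrom v′ (vs , ss))) (sym (east-∸ v<v′)) tt

  compAcc-north : ∀ s c w → compAcc c (north s ++ w) ≡ compAcc (s + c) w
  compAcc-north zero    c       w = refl
  compAcc-north (suc s) zero    w = trans (compAcc-north s 1 w) (cong (λ c → compAcc c w) (+-suc s zero))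
  compAcc-north (suc s) (suc c) w = trans (compAcc-north s (suc (suc c)) w) (cong (λ c → compAcc c w) (+-suc s (suc c)))

  compAcc-close : ∀ c w → BeginsEast w → compAcc (suc c) w ≡ suc c ∷ compAcc 0 w
  compAcc-close c []      _ = refl
  compAcc-close c (E ∷ w) _ = refl

  comp-pathFrom : ∀ {x bl} → WellFormed x bl → comp (pathFrom x bl) ≡ proj₂ bl
  comp-pathFrom {x} [] = walk-east-end (λ _ → comp) (λ _ _ → refl) (m ∸ x) x
  comp-pathFrom {x} (cons {v = v} {suc s} {vs} {ss} x≤v _ wf) = begin
    comp (east (v ∸ x) ++ north (suc s) ++ pathFrom v (vs , ss)) ≡⟨ walk-east-to (λ _ → comp) (λ _ _ → refl) _ x≤v ⟩
    compAcc 0 (north (suc s) ++ pathFrom v (vs , ss))            ≡⟨ compAcc-north (suc s) 0 _ ⟩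
    compAcc (suc s + 0) (pathFrom v (vs , ss))                   ≡⟨ cong (λ c → compAcc (suc c) (pathFrom v (vs , ss))) (+-identityʳ s) ⟩
    compAcc (suc s) (pathFrom v (vs , ss))                       ≡⟨ compAcc-close s _ (pathFrom-beginsEast wf) ⟩
    suc s ∷ comp (pathFrom v (vs , ss))                          ≡⟨ cong (suc s ∷_) (comp-pathFrom (WellFormed-weaken (n≤1+n v) wf)) ⟩
    suc s ∷ ss                                                   ∎

  coarea-north : ∀ s v w → coareaFrom v (north s ++ w) ≡ replicate s v ++ coareaFrom v w
  coarea-north zero    v w = refl
  coarea-north (suc s) v w = cong (v ∷_) (coarea-north s v w)

  ∈ᵇ-replicate : ∀ τ s v us → τ ∈ᵇ (replicate (suc s) v ++ us) ≡ does (τ ≟ v) ∨ τ ∈ᵇ us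
  ∈ᵇ-replicate τ zero    v us = refl
  ∈ᵇ-replicate τ (suc s) v us = trans (cong (does (τ ≟ v) ∨_) (∈ᵇ-replicate τ s v us))
                                      (trans (sym (∨-assoc (does (τ ≟ v)) _ _)) (cong (_∨ τ ∈ᵇ us) (∨-idem _)))

  ∈ᵇ-coarea-pathFrom : ∀ {x bl} → WellFormed x bl → ∀ τ → τ ∈ᵇ coareaFrom x (pathFrom x bl) ≡ τ ∈ᵇ proj₁ bl
  ∈ᵇ-coarea-pathFrom {x} [] τ = cong (τ ∈ᵇ_) (walk-east-end coareaFrom (λ _ _ → refl) (m ∸ x) x)
  ∈ᵇ-coarea-pathFrom {x} (cons {v = v} {suc s} {vs} {ss} x≤v _ wf) τ = begin
    τ ∈ᵇ coareaFrom x (east (v ∸ x) ++ north (suc s) ++ pathFrom v (vs , ss))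
      ≡⟨ cong (τ ∈ᵇ_) (trans (walk-east-to coareaFrom (λ _ _ → refl) _ x≤v) (coarea-north (suc s) v _)) ⟩
    τ ∈ᵇ (replicate (suc s) v ++ coareaFrom v (pathFrom v (vs , ss)))
      ≡⟨ ∈ᵇ-replicate τ s v _ ⟩
    does (τ ≟ v) ∨ τ ∈ᵇ coareaFrom v (pathFrom v (vs , ss))
      ≡⟨ cong (does (τ ≟ v) ∨_) (∈ᵇ-coarea-pathFrom (WellFormed-weaken (n≤1+n v) wf) τ) ⟩
    τ ∈ᵇ (v ∷ vs) ∎

  AboveDiagonal : ℕ × ℕ → Set
  AboveDiagonal = WeaklyAbove m n

  data CornersAbove : ℕ → Blocks → Set where
    []   : ∀ {h} → CornersAbove h ([] , [])
    cons : ∀ {h v s vs ss} → v * n ≤ h * m → CornersAbove (h + s) (vs , ss) → CornersAbove h (v ∷ vs , s ∷ ss)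

  points-east⁺ : ∀ {x v h} w → x ≤ v → v * n ≤ h * m → All AboveDiagonal (pointsFrom v h w) →
                 All AboveDiagonal (pointsFrom x h (east (v ∸ x) ++ w))
  points-east⁺ {x} {v} {h} w x≤v v-above ps = go (v ∸ x) x (subst Corner (sym (m∸n+n≡m x≤v)) (v-above , ps))
    where
      Corner : ℕ → Set
      Corner y = y * n ≤ h * m × All AboveDiagonal (pointsFrom y h w)
      go : ∀ j x → Corner (j + x) → All AboveDiagonal (pointsFrom x h (east j ++ w))
      go zero    x (_ , ps)       = ps
      go (suc j) x corner@(end , _) =
        ≤-trans (*-monoˡ-≤ n (s≤s (m≤n+m x j))) end ∷ go j (suc x) (subst Corner (sym (+-suc j x)) corner)

  points-east⁻ : ∀ {x v h} w → x ≤ v → x * n ≤ h * m → All AboveDiagonal (pointsFrom x h (east (v ∸ x) ++ w)) →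
                 v * n ≤ h * m × All AboveDiagonal (pointsFrom v h w)
  points-east⁻ {x} {v} {h} w x≤v x-above ps = subst Corner (m∸n+n≡m x≤v) (go (v ∸ x) x x-above ps)
    where
      Corner : ℕ → Set
      Corner y = y * n ≤ h * m × All AboveDiagonal (pointsFrom y h w)
      go : ∀ j x → x * n ≤ h * m → All AboveDiagonal (pointsFrom x h (east j ++ w)) → Corner (j + x)
      go zero    x start ps       = start , ps
      go (suc j) x _     (p ∷ ps) = subst Corner (+-suc j x) (go j (suc x) p ps)

  points-north⁺ : ∀ s v h w → v * n ≤ h * m → All AboveDiagonal (pointsFrom v (h + s) w) →
                  All AboveDiagonal (pointsFrom v h (north s ++ w))
  points-north⁺ zero    v h w _       ps = subst (λ y → All AboveDiagonal (pointsFrom v y w)) (+-identityʳ h) ps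
  points-north⁺ (suc s) v h w v-above ps =
    above′ ∷ points-north⁺ s v (suc h) w above′ (subst (λ y → All AboveDiagonal (pointsFrom v y w)) (+-suc h s) ps)
    where above′ = ≤-trans v-above (*-monoˡ-≤ m (n≤1+n h))

  points-north⁻ : ∀ s v h w → All AboveDiagonal (pointsFrom v h (north s ++ w)) →
                  All AboveDiagonal (pointsFrom v (h + s) w)
  points-north⁻ zero    v h w ps       = subst (λ y → All AboveDiagonal (pointsFrom v y w)) (sym (+-identityʳ h)) ps
  points-north⁻ (suc s) v h w (_ ∷ ps) =
    subst (λ y → All AboveDiagonal (pointsFrom v y w)) (sym (+-suc h s)) (points-north⁻ s v (suc h) w ps)

  pathFrom-aboveDiagonal : ∀ {x h bl} → WellFormed x bl → CornersAbove h bl → x ≤ m → All (_≤ m) (proj₁ bl) →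
                     h + sum (proj₂ bl) ≡ n → All AboveDiagonal (pointsFrom x h (pathFrom x bl))
  pathFrom-aboveDiagonal {x} {h} [] [] x≤m _ h≡n =
    subst (All AboveDiagonal ∘ pointsFrom x h) (++-identityʳ (east (m ∸ x)))
          (points-east⁺ [] x≤m (≤-reflexive (trans (*-comm m n) (cong (_* m) (trans (sym h≡n) (+-identityʳ h))))) [])
  pathFrom-aboveDiagonal {x} {h} (cons {v = v} {s} {vs} {ss} x≤v _ wf) (cons v-above above) _ (v≤m ∷ vs≤m) height =
    points-east⁺ _ x≤v v-above (points-north⁺ s v h _ v-above
      (pathFrom-aboveDiagonal (WellFormed-weaken (n≤1+n v) wf) above v≤m vs≤m height′))
    where
      height′ : h + s + sum ss ≡ n
      height′ = trans (+-assoc h s (sum ss)) height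

  aboveDiagonal⇒cornersAbove : ∀ {x h bl} → WellFormed x bl → x * n ≤ h * m →
                               All AboveDiagonal (pointsFrom x h (pathFrom x bl)) → CornersAbove h bl
  aboveDiagonal⇒cornersAbove [] _ _ = []
  aboveDiagonal⇒cornersAbove {x} {h} (cons {v = v} {s} x≤v _ wf) x-above ps =
    cons v-above (aboveDiagonal⇒cornersAbove (WellFormed-weaken (n≤1+n v) wf) (≤-trans v-above (*-monoˡ-≤ m (m≤m+n h s)))
                                   (points-north⁻ s v h _ ps′))
    where
      v-above = proj₁ (points-east⁻ _ x≤v x-above ps)
      ps′ = proj₂ (points-east⁻ _ x≤v x-above ps)

  ret-north : ∀ s v h w → n + v * n ≤ h * m → retFrom m n v h (north s ++ w) ≡ retFrom m n v (h + s) w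
  ret-north zero    v h w _     = cong (λ y → retFrom m n v y w) (sym (+-identityʳ h))
  ret-north (suc s) v h w below = begin
    (if does (h * m <? n + v * n) then 1 else 0) + retFrom m n v (suc h) (north s ++ w)
      ≡⟨ cong (λ b → (if b then 1 else 0) + retFrom m n v (suc h) (north s ++ w))
              (dec-false (h * m <? n + v * n) (≤⇒≯ below)) ⟩
    retFrom m n v (suc h) (north s ++ w)  ≡⟨ ret-north s v (suc h) w (≤-trans below (*-monoˡ-≤ m (n≤1+n h))) ⟩
    retFrom m n v (suc h + s) w           ≡⟨ cong (λ y → retFrom m n v y w) (+-suc h s) ⟨
    retFrom m n v (h + suc s) w           ∎

module Dyck (m n : ℕ) .{{_ : NonZero n}} (n<m : n < m) where

  open Lattice m n

  k : ℕ
  k = m / n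

  0<k : 0 < k
  0<k = m≥n⇒m/n>0 (<⇒≤ n<m)

  open Ceilings k 0<k

  ceiling : ℕ → ℕ
  ceiling h = h * m / n

  ceilings : ℕ → List ℕ → List ℕ
  ceilings h []       = []
  ceilings h (s ∷ ss) = ceiling h ∷ ceilings (h + s) ss

  k≤ceiling : ∀ {h} → 1 ≤ h → k ≤ ceiling h
  k≤ceiling {h} 1≤h = m*n≤o⇒m≤o/n (≤-trans (m/n*n≤m m n) (subst (_≤ h * m) (*-identityˡ m) (*-monoˡ-≤ m 1≤h)))

  ceiling-step : ∀ h {s} → 1 ≤ s → ceiling h + k ≤ ceiling (h + s)
  ceiling-step h {s} 1≤s = m*n≤o⇒m≤o/n (begin
    (ceiling h + k) * n       ≡⟨ *-distribʳ-+ n (ceiling h) k ⟩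
    ceiling h * n + k * n     ≤⟨ +-mono-≤ (m/n*n≤m (h * m) n) (m/n*n≤m m n) ⟩
    h * m + m                 ≤⟨ +-monoʳ-≤ (h * m) (subst (_≤ s * m) (*-identityˡ m) (*-monoˡ-≤ m 1≤s)) ⟩
    h * m + s * m             ≡⟨ *-distribʳ-+ m h s ⟨
    (h + s) * m               ∎)
    where open ≤-Reasoning

  Spaced-ceilings : ∀ {lo} h {ss} → All (1 ≤_) ss → lo ≤ ceiling h → Spaced lo (ceilings h ss)
  Spaced-ceilings h []           _  = []
  Spaced-ceilings h (1≤s ∷ 1≤ss) lo≤ = cons lo≤ (Spaced-ceilings _ 1≤ss (ceiling-step h 1≤s))

  admissible⇒wellFormed : ∀ {b h vs ss} → Admissible b (ceilings h ss) vs → All (1 ≤_) ss → WellFormed (suc b) (vs , ss)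
  admissible⇒wellFormed {ss = []}    []               []           = []
  admissible⇒wellFormed {ss = _ ∷ _} (cons b<v _ adm) (1≤s ∷ 1≤ss) = cons b<v 1≤s (admissible⇒wellFormed adm 1≤ss)

  admissible⇒cornersAbove : ∀ {b h vs ss} → Admissible b (ceilings h ss) vs → CornersAbove h (vs , ss)
  admissible⇒cornersAbove {ss = []}    []               = []
  admissible⇒cornersAbove {ss = _ ∷ _} (cons _ v≤c adm) = cons (m≤o/n⇒m*n≤o v≤c) (admissible⇒cornersAbove adm)

  cornersAbove⇒admissible : ∀ {b h vs ss} → WellFormed (suc b) (vs , ss) → CornersAbove h (vs , ss) → Admissible b (ceilings h ss) vs
  cornersAbove⇒admissible []                [] = []
  cornersAbove⇒admissible (cons b<v _ wf) (cons v-above above) = cons b<v (m*n≤o⇒m≤o/n v-above) (cornersAbove⇒admissible wf above)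

  wellFormed-sizes : ∀ {x vs ss} → WellFormed x (vs , ss) → All (1 ≤_) ss
  wellFormed-sizes []               = []
  wellFormed-sizes (cons _ 1≤s wf) = 1≤s ∷ wellFormed-sizes wf

  cornersAbove⇒≤m : ∀ {h vs ss} → CornersAbove h (vs , ss) → h + sum ss ≤ n → All (_≤ m) vs
  cornersAbove⇒≤m []                          _     = []
  cornersAbove⇒≤m {h} (cons {v = v} {s} {ss = ss} v-above above) h+≤n =
    *-cancelʳ-≤ v m n (≤-trans v-above (≤-trans (*-monoˡ-≤ m h≤n) (≤-reflexive (*-comm n m))))
      ∷ cornersAbove⇒≤m above (subst (_≤ n) (sym (+-assoc h s (sum ss))) h+≤n)
    where h≤n = ≤-trans (m≤m+n h (s + sum ss)) h+≤n

  length-≤-sum : ∀ {b h vs ss} → Admissible b (ceilings h ss) vs → All (1 ≤_) ss → length vs ≤ sum ss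
  length-≤-sum {ss = []}    []             []           = z≤n
  length-≤-sum {ss = _ ∷ _} (cons _ _ adm) (1≤s ∷ 1≤ss) = +-mono-≤ 1≤s (length-≤-sum adm 1≤ss)

  return-indicator : ∀ {v h} cs vs → v * n ≤ h * m →
                     (if does (h * m <? n + v * n) then 1 else 0) + touches cs vs ≡ touches (ceiling h ∷ cs) (v ∷ vs)
  return-indicator {v} {h} cs vs v-above with v ≟ ceiling h
  ... | yes v≡ = cong (λ b → (if b then 1 else 0) + touches cs vs) (dec-true (h * m <? n + v * n) (m≡o/n⇒o<n+m*n v≡))
  ... | no v≢  = cong (λ b → (if b then 1 else 0) + touches cs vs)
                      (dec-false (h * m <? n + v * n) (v≢ ∘ o<n+m*n⇒m≡o/n (m*n≤o⇒m≤o/n v-above)))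

  ret-pathFrom : ∀ {x h bl} → WellFormed x bl → CornersAbove h bl →
                 retFrom m n x h (pathFrom x bl) ≡ touches (ceilings h (proj₂ bl)) (proj₁ bl)
  ret-pathFrom {x} {h} [] [] = walk-east-end (λ y → retFrom m n y h) (λ _ _ → refl) (m ∸ x) x
  ret-pathFrom {x} {h} (cons {v = v} {suc s} {vs} {ss} x≤v _ wf) (cons v-above above) = begin
    retFrom m n x h (east (v ∸ x) ++ north (suc s) ++ pathFrom v (vs , ss))
      ≡⟨ walk-east-to (λ y → retFrom m n y h) (λ _ _ → refl) _ x≤v ⟩
    returned + retFrom m n v (suc h) (north s ++ pathFrom v (vs , ss))
      ≡⟨ cong (returned +_) (ret-north s v (suc h) _ (+-mono-≤ (<⇒≤ n<m) v-above)) ⟩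
    returned + retFrom m n v (suc h + s) (pathFrom v (vs , ss))
      ≡⟨ cong (λ y → returned + retFrom m n v y (pathFrom v (vs , ss))) (+-suc h s) ⟨
    returned + retFrom m n v (h + suc s) (pathFrom v (vs , ss))
      ≡⟨ cong (returned +_) (ret-pathFrom (WellFormed-weaken (n≤1+n v) wf) above) ⟩
    returned + touches (ceilings (h + suc s) ss) vs
      ≡⟨ return-indicator {v} {h} (ceilings (h + suc s) ss) vs v-above ⟩
    touches (ceilings h (suc s ∷ ss)) (v ∷ vs) ∎
    where
      open ≡-Reasoning
      returned = if does (h * m <? n + v * n) then 1 else 0

  record Shape (b₁ : ℕ) (vs ss : List ℕ) : Set where
    field
      first>0    : 1 ≤ b₁
      sizes>0    : All (1 ≤_) ss
      admissible : Admissible 0 (ceilings b₁ ss) vs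
      height     : b₁ + sum ss ≡ n

  pathOf : ℕ → List ℕ → List ℕ → List Step
  pathOf b₁ vs ss = pathFrom 0 (0 ∷ vs , b₁ ∷ ss)

  module _ {b₁ vs ss} (S : Shape b₁ vs ss) where
    open Shape S

    shape-wellFormed : WellFormed 0 (0 ∷ vs , b₁ ∷ ss)
    shape-wellFormed = cons z≤n first>0 (admissible⇒wellFormed admissible sizes>0)

    shape-cornersAbove : CornersAbove 0 (0 ∷ vs , b₁ ∷ ss)
    shape-cornersAbove = cons z≤n (admissible⇒cornersAbove admissible)

    shape-isDyck : IsDyck m n (pathOf b₁ vs ss)
    shape-isDyck = trans (sym (+-identityʳ _)) (#E-pathFrom shape-wellFormed z≤n (z≤n ∷ vs≤m))
                 , trans (#N-pathFrom shape-wellFormed) height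
                 , pathFrom-aboveDiagonal shape-wellFormed shape-cornersAbove z≤n (z≤n ∷ vs≤m) height
      where vs≤m = cornersAbove⇒≤m (admissible⇒cornersAbove admissible) (≤-reflexive height)

    comp-pathOf : comp (pathOf b₁ vs ss) ≡ b₁ ∷ ss
    comp-pathOf = comp-pathFrom shape-wellFormed

    ret-pathOf : ret m n (pathOf b₁ vs ss) ≡ suc (touches (ceilings b₁ ss) vs)
    ret-pathOf = trans (ret-pathFrom shape-wellFormed shape-cornersAbove)
                       (trans (cong (λ c → touches (c ∷ ceilings b₁ ss) (0 ∷ vs)) (0/n≡0 n)) (touches-≡ 0 (ceilings b₁ ss) vs))

    runTilde-pathOf : runTilde m n (pathOf b₁ vs ss) ≡ suc (run k vs)
    runTilde-pathOf = trans (firstMissing-run n 1 admissible (subst (0 <_) (sym (*-identityʳ k)) 0<k) agree run<)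
                            (cong (λ τ → suc (run τ vs)) (*-identityʳ k))
      where
        agree : ∀ τ → 0 < τ → τ ∈ᵇ coarea (pathOf b₁ vs ss) ≡ τ ∈ᵇ vs
        agree (suc τ) _ = ∈ᵇ-coarea-pathFrom shape-wellFormed (suc τ)
        run< : run (k * 1) vs < n
        run< = ≤-trans (s≤s (≤-trans (run-≤-length _ vs) (length-≤-sum admissible sizes>0)))
                       (≤-trans (+-monoˡ-≤ (sum ss) first>0) (≤-reflexive height))

    swapped : Exchanges (Admissible 0 (ceilings b₁ ss)) (touches (ceilings b₁ ss)) (run k) (swap k (ceilings b₁ ss)) vs
    swapped = swap-spec 0<k (Spaced-ceilings b₁ sizes>0 (k≤ceiling first>0)) admissible

    shape-swap : Shape b₁ (swap k (ceilings b₁ ss) vs) ss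
    shape-swap = record { first>0 = first>0 ; sizes>0 = sizes>0 ; admissible = Exchanges.ok swapped ; height = height }

  data View : List Step → Set where
    shaped : ∀ {b₁ vs ss} → Shape b₁ vs ss → View (pathOf b₁ vs ss)

  view-blocks : ∀ {bl} → WellFormed 0 bl → CornersAbove 0 bl → #N (pathFrom 0 bl) ≡ n → View (pathFrom 0 bl)
  view-blocks [] [] #N≡n = contradiction (trans (sym (#N-pathFrom {0} [])) #N≡n) (≢-nonZero⁻¹ n ∘ sym)
  view-blocks wf₀@(cons {v = v₀} _ 1≤b₁ wf) (cons v₀-above above) #N≡n with *-cancelʳ-≤ v₀ 0 n v₀-above
  ... | z≤n = shaped (record { first>0 = 1≤b₁ ; sizes>0 = wellFormed-sizes wf ; admissible = cornersAbove⇒admissible wf above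
                             ; height = trans (sym (#N-pathFrom wf₀)) #N≡n })

  view : ∀ {w} → IsDyck m n w → View w
  view {w} (#E≡m , #N≡n , points) =
    subst View path≡ (view-blocks wf (aboveDiagonal⇒cornersAbove wf z≤n points′) (trans (cong #N path≡) #N≡n))
    where
      wf = WellFormed-blocksFrom 0 w
      path≡ = pathFrom-blocksFrom 0 w (trans (+-identityʳ _) #E≡m)
      points′ = subst (All AboveDiagonal ∘ pointsFrom 0 0) (sym path≡) points

  respace : Blocks → Blocks
  respace (v₀ ∷ vs , b₁ ∷ ss) = v₀ ∷ swap k (ceilings b₁ ss) vs , b₁ ∷ ss
  respace bl                  = bl

  ψ : List Step → List Step
  ψ w = pathFrom 0 (respace (blocksFrom 0 w))

  ψ-pathOf : ∀ {b₁ vs ss} → Shape b₁ vs ss → ψ (pathOf b₁ vs ss) ≡ pathOf b₁ (swap k (ceilings b₁ ss) vs) ss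
  ψ-pathOf S = cong (pathFrom 0 ∘ respace) (blocksFrom-pathFrom (shape-wellFormed S))

  ψ-isDyck : ∀ {w} → IsDyck m n w → IsDyck m n (ψ w)
  ψ-isDyck d with view d
  ... | shaped S = subst (IsDyck m n) (sym (ψ-pathOf S)) (shape-isDyck (shape-swap S))

  ψ-spec : ∀ {w} → IsDyck m n w →
           ψ (ψ w) ≡ w × comp (ψ w) ≡ comp w × runTilde m n (ψ w) ≡ ret m n w × ret m n (ψ w) ≡ runTilde m n w
  ψ-spec d with view d
  ... | shaped {b₁} {vs} {ss} S =
      trans (cong ψ ψ≡) (trans (ψ-pathOf (shape-swap S)) (cong (λ vs′ → pathOf b₁ vs′ ss) involutive))
    , trans (cong comp ψ≡) (trans (comp-pathOf (shape-swap S)) (sym (comp-pathOf S)))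
    , trans (cong (runTilde m n) ψ≡) (trans (runTilde-pathOf (shape-swap S)) (trans (cong suc r-swap) (sym (ret-pathOf S))))
    , trans (cong (ret m n) ψ≡) (trans (ret-pathOf (shape-swap S)) (trans (cong suc a-swap) (sym (runTilde-pathOf S))))
    where
      ψ≡ = ψ-pathOf S
      open Exchanges (swapped S)

theorem3p6 : (m n : ℕ) → .{{_ : NonZero n}} → n < m →
    Σ (Dyck m n → Dyck m n) (λ Ψ → (P : Dyck m n) →
        (path (Ψ (Ψ P)) ≡ path P)
      × (comp (path (Ψ P)) ≡ comp (path P))
      × (runTilde m n (path (Ψ P)) ≡ ret m n (path P))
      × (ret m n (path (Ψ P)) ≡ runTilde m n (path P)))
theorem3p6 m n n<m = (λ (w , d) → ψ w , ψ-isDyck d) , λ (w , d) → ψ-spec d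
  where open Dyck m n n<m
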